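{- Let $p>2$ be a prime number. The sequence $IT'$ (the concatenation of $I$ followed by $T'$, as defined in the context) is a $2$-radius sequence of length $p^2+p$ over the $2p$-element alphabet $X=\{0,1,\ldots,p-1\}\cup\{\underline{0},\underline{1},\ldots,\underline{p-1}\}$.
   Context: A sequence $x_1,\ldots,x_m$ over an alphabet $X$ is a $2$-radius sequence if for every $a,b\in X$ there are indices $i,j$ with $x_i=a$, $x_j=b$, $|i-j|\leq 2$. Let $p>2$ be prime. The sets $A=\{0,\ldots,p-1\}$ and $\underline{A}=\{\underline{0},\ldots,\underline{p-1}\}$ are each identified with $\mathbb{Z}_p$; all arithmetic inside an element (e.g. $\underline{a}$ with $a$ an integer expression) is modulo $p$. Let $h=\frac{p-1}{2}$. For $j\in\{1,\ldots,h\}$ define $x^{(j)}_m$ for $m=0,1,\ldots,2p-1$ by $x^{(j)}_m=(mj \bmod p)\in A$ if $m$ is even and $x^{(j)}_m=\underline{mj \bmod p}\in\underline{A}$ if $m$ is odd (so $x^{(j)}_0,\ldots,x^{(j)}_{2p-1}$ is $0,\underline{j},2j,\underline{3j},\ldots$). Let $r_j$ be the unique odd integer in $\{1,\ldots,2p-1\}$ with $r_j j\equiv 1 \pmod p$ (so $x^{(j)}_{r_j}=\underline{1}$). Put $I_j'=x^{(j)}_0,\ldots,x^{(j)}_{r_j-1}$ and $I_j''=x^{(j)}_{r_j},\ldots,x^{(j)}_{2p-1}$. For $j\in\{1,\ldots,h\}$ let $J_j=I_j'$ if $j$ is odd and $J_j=I_j''$ if $j$ is even, and let $\hat J_j=I_j''$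 if $j$ is odd and $\hat J_j=I_j'$ if $j$ is even. Define $I=J_1J_2\cdots J_h\hat J_h\hat J_{h-1}\cdots\hat J_1$ (concatenation). Define $T=(t_1,\ldots,t_{2p})$ by $t_i=\underline{ -\frac{i-1}{2}}$ if $i\equiv1\pmod 4$, $t_i=-\frac{i-2}{2}$ if $i\equiv 2\pmod 4$, $t_i=\frac{i+1}{2}$ if $i\equiv 3\pmod 4$, $t_i=\underline{\frac{i}{2}}$ if $i\equiv 0\pmod 4$ (values mod $p$); i.e. $T=\underline{0},0,2,\underline{2},\underline{ -2},-2,4,\underline{4},\ldots,-1,\underline{ -1},\underline{1},1$. $T'$ is obtained from $T$ by swapping its first two terms. -}

module Defs where

open import Data.Nat using (ℕ; zero; suc; _+_; _*_; _∸_; _≤_; _≟_; NonZero; ∣_-_∣)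
open import Data.Nat.DivMod using (_%_; _/_; m%n<n)

open import Data.Fin using (Fin; fromℕ<; toℕ)
open import Data.Sum using (_⊎_; inj₁; inj₂)
open import Data.Product using (Σ; _×_; _,_)
open import Data.List using (List; []; _∷_; map; upTo; concat; reverse; filter; length; lookup; _++_)
open import Relation.Binary.PropositionalEquality using (_≡_)
open import Relation.Nullary.Decidable using (does; ¬?)
open import Data.Bool using (if_then_else_)

Is2Radius : {X : Set} → List X → Set
Is2Radius {X} s = (a b : X) → Σ (Fin (length s)) λ i → Σ (Fin (length s)) λ j →
  (lookup s i ≡ a) × (lookup s j ≡ b) × (∣ toℕ i - toℕ j ∣ ≤ 2)

module _ (p : ℕ) .{{_ : NonZero p}} where

  -- The alphabet X = A ∪ A̲ : inj₁ a is a ∈ A, inj₂ a is the underlined a̲ ∈ A̲.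
  Letter : Set
  Letter = Fin p ⊎ Fin p

  res : ℕ → Fin p
  res x = fromℕ< (m%n<n x p)

  negRes : ℕ → Fin p
  negRes x = res (p ∸ (x % p))

  plain : ℕ → Letter
  plain x = inj₁ (res x)

  under : ℕ → Letter
  under x = inj₂ (res x)

  h : ℕ
  h = (p ∸ 1) / 2

  xj : ℕ → ℕ → Letter
  xj j m = if does (m % 2 ≟ 0) then plain (m * j) else under (m * j)

  odds : List ℕ
  odds = map (λ k → 2 * k + 1) (upTo p)

  -- r_j : the (unique) odd r ∈ {1,…,2p−1} with r j ≡ 1 (mod p); first one found
  -- (0 if none exists, which does not happen for p prime, 1 ≤ j ≤ h).
  r : ℕ → ℕ
  r j with filter (λ m → ((m * j) % p) ≟ 1) odds
  ... | [] = 0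
  ... | m ∷ _ = m

  I′ : ℕ → List Letter
  I′ j = map (xj j) (upTo (r j))

  I″ : ℕ → List Letter
  I″ j = map (λ k → xj j (r j + k)) (upTo (2 * p ∸ r j))

  J : ℕ → List Letter
  J j = if does (j % 2 ≟ 0) then I″ j else I′ j

  Ĵ : ℕ → List Letter
  Ĵ j = if does (j % 2 ≟ 0) then I′ j else I″ j

  oneToH : List ℕ
  oneToH = map suc (upTo h)

  I : List Letter
  I = concat (map J oneToH) ++ concat (map Ĵ (reverse oneToH))

  t : ℕ → Letter
  t i with i % 4
  ... | 1 = inj₂ (negRes ((i ∸ 1) / 2))
  ... | 2 = inj₁ (negRes ((i ∸ 2) / 2))
  ... | 3 = plain ((i + 1) / 2)
  ... | _ = under (i / 2)

  T : List Letter
  T = map (λ k → t (suc k)) (upTo (2 * p))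

  swap12 : {A : Set} → List A → List A
  swap12 (a ∷ b ∷ rest) = b ∷ a ∷ rest
  swap12 l = l

  T′ : List Letter
  T′ = swap12 T

  IT′ : List Letter
  IT′ = I ++ T′

module Submission where

-- Row j (1 ≤ j ≤ h, p = 1 + 2h) is the cyclic word x₀ x₁ ⋯ x_{2p−1} with x_m = m·j mod p, plain for
-- even m and underlined for odd m; I cuts it at x_r = 1̲ into the halves I′_j and I″_j.  In IT′ each
-- I′_j is followed by 1̲ and each I″_j by 0 (the first letters of the neighbouring blocks, or of T′),
-- so all cyclically adjacent pairs x_m, x_{m+1} and x_m, x_{m+2} of the row are near in IT′, except
-- x_{r−1}, x_{r+1} and x_{2p−1}, x_{2p+1}.  These are the pairs {1−j, 1+j} and {−j̲, j̲}, and T′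
-- contains them together with every pair {v, v̲}.  As every residue is an even and an odd multiple
-- of j, the rows put v next to (v+j)̲ and v+2j, and v̲ next to v+j and (v+2j)̲; so any two letters
-- are equal up to the underline or one such step apart.  The length is h rows of 2p plus 2p.

open import Defs
open import Data.Bool using (Bool; true; false; not; if_then_else_)
open import Data.Empty using (⊥-elim)
open import Data.Fin using (Fin; toℕ) renaming (zero to fzero; suc to fsuc)
open import Data.Fin.Properties using (fromℕ<-cong; fromℕ<-toℕ; toℕ<n)
open import Data.List using (List; []; _∷_; [_]; _++_; concat; filter; map; reverse; applyUpTo; applyDownFrom; length; lookup)
open import Data.List.Membership.Propositional using (_∈_)
open import Data.List.Membership.Propositional.Properties using (∈-filter⁺; ∈-filter⁻; ∈-map⁺; ∈-map⁻; ∈-upTo⁺; ∈-upTo⁻)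
open import Data.List.Properties using (++-assoc; ++-identityʳ; applyUpTo-∷ʳ; map-applyUpTo; map-++; concat-++; length-++; length-applyUpTo; reverse-applyUpTo)
open import Data.List.Relation.Unary.Any using (here)
open import Data.Nat using (ℕ; zero; suc; pred; _+_; _*_; _∸_; _<_; _≤_; z≤n; s≤s; s≤s⁻¹; NonZero; >-nonZero⁻¹; ∣_-_∣; _≟_)
open import Data.Nat.Coprimality using (coprime-Bézout; prime⇒coprime)
open import Data.Nat.Divisibility using (divides)
open import Data.Nat.DivMod using (_%_; _/_; %-distribˡ-+; %-distribˡ-*; m*n%n≡0; m<n⇒m%n≡m; m%n%n≡m%n; m%n<n; m*n/n≡m; [m+kn]%n≡m%n; [m+n]%n≡m%n)
open import Data.Nat.GCD using (module Bézout)
open import Data.Nat.Primality using (Prime; prime⇒irreducible)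
open import Data.Nat.Properties
open import Data.Nat.Tactic.RingSolver using (solve-∀)
open import Data.Product using (Σ; _×_; _,_; proj₁; proj₂)
open import Data.Sum using (_⊎_; inj₁; inj₂)
open import Function using (_∘_; id)
open import Level using (0ℓ)
open import Relation.Binary.Bundles using (Setoid)
open import Relation.Binary.PropositionalEquality using (_≡_; refl; sym; trans; cong; cong₂; subst; subst₂; module ≡-Reasoning)
import Relation.Binary.Reasoning.Setoid as SetoidReasoning
open import Relation.Nullary using (does)
open import Relation.Unary using (Pred; Decidable)

data Gap : ℕ → Set where
  one : Gap 1
  two : Gap 2

module Proximity {A : Set} where

  data Near : List A → A → A → Set where
    adj₁  : ∀ {x y l}   → Near (x ∷ y ∷ l) x y
    adj₂  : ∀ {x y z l} → Near (x ∷ z ∷ y ∷ l) x y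
    flip  : ∀ {x y l}   → Near l x y → Near l y x
    there : ∀ {x y z l} → Near l x y → Near (z ∷ l) x y

  Close : List A → A → A → Set
  Close s a b = Σ (Fin (length s)) λ i → Σ (Fin (length s)) λ j →
    (lookup s i ≡ a) × (lookup s j ≡ b) × (∣ toℕ i - toℕ j ∣ ≤ 2)

  near⇒close : ∀ {s a b} → Near s a b → Close s a b
  near⇒close adj₁      = fzero , fsuc fzero , refl , refl , s≤s z≤n
  near⇒close adj₂      = fzero , fsuc (fsuc fzero) , refl , refl , s≤s (s≤s z≤n)
  near⇒close (flip n) with near⇒close n
  ... | i , j , eᵢ , eⱼ , d = j , i , eⱼ , eᵢ , subst (_≤ 2) (∣-∣-comm (toℕ i) (toℕ j)) d
  near⇒close (there n) with near⇒close n
  ... | i , j , eᵢ , eⱼ , d = fsuc i , fsuc j , eᵢ , eⱼ , d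

  close-refl : ∀ {s a b} → Close s a b → Close s a a
  close-refl (i , _ , eᵢ , _ , _) = i , i , eᵢ , eᵢ , subst (_≤ 2) (sym (∣n-n∣≡0 (toℕ i))) z≤n

  Infix : List A → List A → Set
  Infix s t = Σ (List A) λ pre → Σ (List A) λ post → t ≡ pre ++ s ++ post

  near-infix : ∀ {s t a b} → Infix s t → Near s a b → Near t a b
  near-infix (pre , post , refl) = prepend pre ∘ append
    where
      prepend : ∀ pre {s a b} → Near s a b → Near (pre ++ s) a b
      prepend []         n = n
      prepend (_ ∷ pre) n = there (prepend pre n)
      append : ∀ {s a b} → Near s a b → Near (s ++ post) a b
      append adj₁      = adj₁
      append adj₂      = adj₂
      append (flip n)  = flip (append n)
      append (there n) = there (append n)

  infix-trans : ∀ {s t u} → Infix s t → Infix t u → Infix s u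
  infix-trans {s} (pre , post , refl) (pre′ , post′ , refl) =
    pre′ ++ pre , post ++ post′ , (begin
      pre′ ++ (pre ++ s ++ post) ++ post′ ≡⟨ cong (pre′ ++_) (++-assoc pre (s ++ post) post′) ⟩
      pre′ ++ pre ++ (s ++ post) ++ post′ ≡⟨ cong (λ z → pre′ ++ pre ++ z) (++-assoc s post post′) ⟩
      pre′ ++ pre ++ s ++ post ++ post′   ≡⟨ sym (++-assoc pre′ pre _) ⟩
      (pre′ ++ pre) ++ s ++ post ++ post′ ∎)
    where open ≡-Reasoning

  infix-prefix : ∀ s u → Infix s (s ++ u)
  infix-prefix s u = [] , u , refl

  infix-++ʳ : ∀ {s t} u → Infix s t → Infix s (t ++ u)
  infix-++ʳ u i = infix-trans i (infix-prefix _ u)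

  infix-suffix : ∀ u s → Infix s (u ++ s)
  infix-suffix u s = u , [] , cong (u ++_) (sym (++-identityʳ s))

  Starts : A → List A → Set
  Starts x l = Σ (List A) λ rest → l ≡ x ∷ rest

  applyUpTo-starts : ∀ (f : ℕ → A) {n} → 0 < n → Starts (f 0) (applyUpTo f n)
  applyUpTo-starts f {suc n} _ = applyUpTo (f ∘ suc) n , refl

  followed-by : ∀ {s t x u} → Starts x t → Infix (s ++ t) u → Infix (s ++ [ x ]) u
  followed-by {s} {x = x} (rest , refl) i = infix-trans ([] , rest , sym (++-assoc s [ x ] rest)) i

  window : ∀ (f : ℕ → A) {n m d} → Gap d → m + d < n → Near (applyUpTo f n) (f m) (f (m + d))
  window f {suc (suc n)} {zero} one _ = adj₁
  window f {suc (suc (suc n))} {zero} two _ = adj₂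
  window f {suc zero} {zero} one (s≤s ())
  window f {suc (suc zero)} {zero} two (s≤s (s≤s ()))
  window f {suc n} {suc m} g (s≤s lt) = there (window (f ∘ suc) g lt)

  rising : (ℕ → List A) → ℕ → List A
  rising F zero    = []
  rising F (suc n) = rising F n ++ F (suc n)

  falling : (ℕ → List A) → ℕ → List A
  falling F zero    = []
  falling F (suc n) = F (suc n) ++ falling F n

  rising-concat : ∀ F n → concat (map F (applyUpTo suc n)) ≡ rising F n
  rising-concat F zero    = refl
  rising-concat F (suc n) = begin
    concat (map F (applyUpTo suc (suc n)))             ≡⟨ cong (concat ∘ map F) (sym (applyUpTo-∷ʳ suc n)) ⟩
    concat (map F (applyUpTo suc n ++ [ suc n ]))      ≡⟨ cong concat (map-++ F (applyUpTo suc n) [ suc n ]) ⟩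
    concat (map F (applyUpTo suc n) ++ [ F (suc n) ])  ≡⟨ sym (concat-++ (map F (applyUpTo suc n)) [ F (suc n) ]) ⟩
    concat (map F (applyUpTo suc n)) ++ F (suc n) ++ [] ≡⟨ cong₂ _++_ (rising-concat F n) (++-identityʳ (F (suc n))) ⟩
    rising F n ++ F (suc n)                            ∎
    where open ≡-Reasoning

  falling-concat : ∀ F n → concat (map F (applyDownFrom suc n)) ≡ falling F n
  falling-concat F zero    = refl
  falling-concat F (suc n) = cong (F (suc n) ++_) (falling-concat F n)

  rising-adjacent : ∀ F {j n} → suc (suc j) ≤ n → Infix (F (suc j) ++ F (suc (suc j))) (rising F n)
  rising-adjacent F {j} le with m≤n⇒∃[o]m+o≡n le
  ... | k , refl = subst (Infix (F (suc j) ++ F (suc (suc j))) ∘ rising F) (+-comm k (suc (suc j))) (adjacent k)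
    where
      adjacent : ∀ k → Infix (F (suc j) ++ F (suc (suc j))) (rising F (k + suc (suc j)))
      adjacent zero    = rising F j , [] , (begin
        (rising F j ++ F (suc j)) ++ F (suc (suc j))        ≡⟨ ++-assoc (rising F j) (F (suc j)) _ ⟩
        rising F j ++ F (suc j) ++ F (suc (suc j))          ≡⟨ cong (rising F j ++_) (sym (++-identityʳ _)) ⟩
        rising F j ++ (F (suc j) ++ F (suc (suc j))) ++ [] ∎)
        where open ≡-Reasoning
      adjacent (suc k) = infix-trans (adjacent k) (infix-prefix _ _)

  falling-adjacent : ∀ F {j n} → suc (suc j) ≤ n → Infix (F (suc (suc j)) ++ F (suc j)) (falling F n)
  falling-adjacent F {j} le with m≤n⇒∃[o]m+o≡n le
  ... | k , refl = subst (Infix (F (suc (suc j)) ++ F (suc j)) ∘ falling F) (+-comm k (suc (suc j))) (adjacent k)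
    where
      adjacent : ∀ k → Infix (F (suc (suc j)) ++ F (suc j)) (falling F (k + suc (suc j)))
      adjacent zero    = [] , falling F j , sym (++-assoc (F (suc (suc j))) (F (suc j)) (falling F j))
      adjacent (suc k) = infix-trans (adjacent k) (infix-suffix _ _)

  rising-falling-meet : ∀ F G {n} → 0 < n → Infix (F n ++ G n) (rising F n ++ falling G n)
  rising-falling-meet F G {suc n} _ = rising F n , falling G n , (begin
    (rising F n ++ F (suc n)) ++ G (suc n) ++ falling G n   ≡⟨ ++-assoc (rising F n) (F (suc n)) _ ⟩
    rising F n ++ F (suc n) ++ G (suc n) ++ falling G n     ≡⟨ cong (rising F n ++_) (sym (++-assoc (F (suc n)) _ _)) ⟩
    rising F n ++ (F (suc n) ++ G (suc n)) ++ falling G n   ∎)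
    where open ≡-Reasoning

  falling-then : ∀ F u {n} → 0 < n → Infix (F 1 ++ u) (falling F n ++ u)
  falling-then F u {suc zero} _ = [] , [] , (begin
    (F 1 ++ []) ++ u ≡⟨ cong (_++ u) (++-identityʳ (F 1)) ⟩
    F 1 ++ u         ≡⟨ ++-identityʳ (F 1 ++ u) ⟨
    (F 1 ++ u) ++ [] ∎)
    where open ≡-Reasoning
  falling-then F u {suc (suc n)} _ =
    subst (Infix (F 1 ++ u)) (sym (++-assoc (F (suc (suc n))) (falling F (suc n)) u))
      (infix-trans (falling-then F u {suc n} (s≤s z≤n)) (infix-suffix (F (suc (suc n))) _))

  length-runs : ∀ F G c n → (∀ k → 0 < k → k ≤ n → length (F k) + length (G k) ≡ c) →
                length (rising F n ++ falling G n) ≡ n * c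
  length-runs F G c zero    _  = refl
  length-runs F G c (suc n) pairs = begin
    length ((rising F n ++ F (suc n)) ++ G (suc n) ++ falling G n)
      ≡⟨ length-++ (rising F n ++ F (suc n)) ⟩
    length (rising F n ++ F (suc n)) + length (G (suc n) ++ falling G n)
      ≡⟨ cong₂ _+_ (length-++ (rising F n)) (length-++ (G (suc n))) ⟩
    (length (rising F n) + length (F (suc n))) + (length (G (suc n)) + length (falling G n))
      ≡⟨ regroup (length (rising F n)) (length (F (suc n))) (length (G (suc n))) (length (falling G n)) ⟩
    (length (F (suc n)) + length (G (suc n))) + (length (rising F n) + length (falling G n))
      ≡⟨ cong₂ _+_ (pairs (suc n) (s≤s z≤n) ≤-refl) (trans (sym (length-++ (rising F n)))
           (length-runs F G c n (λ k 0<k k≤n → pairs k 0<k (m≤n⇒m≤1+n k≤n)))) ⟩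
    c + n * c ∎
    where
      open ≡-Reasoning
      regroup : ∀ a b c d → (a + b) + (c + d) ≡ (b + c) + (a + d)
      regroup = solve-∀

open Proximity

module Modular (p : ℕ) .{{_ : NonZero p}} where

  infix 4 _≋_
  _≋_ : ℕ → ℕ → Set
  x ≋ y = x % p ≡ y % p

  ≋-setoid : Setoid 0ℓ 0ℓ
  ≋-setoid = record
    { Carrier = ℕ ; _≈_ = _≋_
    ; isEquivalence = record { refl = refl ; sym = sym ; trans = trans } }

  module ≋-Reasoning = SetoidReasoning ≋-setoid

  ≡⇒≋ : ∀ {x y} → x ≡ y → x ≋ y
  ≡⇒≋ = cong (_% p)

  +-≋ : ∀ {a b c d} → a ≋ b → c ≋ d → a + c ≋ b + d
  +-≋ {a} {b} {c} {d} a≋b c≋d = begin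
    (a + c) % p          ≡⟨ %-distribˡ-+ a c p ⟩
    (a % p + c % p) % p  ≡⟨ cong₂ (λ u v → (u + v) % p) a≋b c≋d ⟩
    (b % p + d % p) % p  ≡⟨ %-distribˡ-+ b d p ⟨
    (b + d) % p          ∎
    where open ≡-Reasoning

  *-≋ : ∀ {a b c d} → a ≋ b → c ≋ d → a * c ≋ b * d
  *-≋ {a} {b} {c} {d} a≋b c≋d = begin
    (a * c) % p              ≡⟨ %-distribˡ-* a c p ⟩
    (a % p * (c % p)) % p    ≡⟨ cong₂ (λ u v → (u * v) % p) a≋b c≋d ⟩
    (b % p * (d % p)) % p    ≡⟨ %-distribˡ-* b d p ⟨
    (b * d) % p              ∎
    where open ≡-Reasoning

  *p≋0 : ∀ k → k * p ≋ 0
  *p≋0 k = trans (m*n%n≡0 k p) (sym (m<n⇒m%n≡m (>-nonZero⁻¹ p)))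

  p≋0 : p ≋ 0
  p≋0 = trans (≡⇒≋ (sym (*-identityˡ p))) (*p≋0 1)

  %-≋ : ∀ x → x % p ≋ x
  %-≋ x = m%n%n≡m%n x p

  neg : ℕ → ℕ
  neg x = p ∸ x % p

  +-neg : ∀ x → x + neg x ≋ 0
  +-neg x = begin
    x + neg x            ≈⟨ +-≋ {x} {x % p} (sym (%-≋ x)) refl ⟩
    x % p + neg x        ≡⟨ m+[n∸m]≡n (<⇒≤ (m%n<n x p)) ⟩
    p                    ≈⟨ p≋0 ⟩
    0                    ∎
    where open ≋-Reasoning

  +-cancelʳ-≋ : ∀ {a b} c → a + c ≋ b + c → a ≋ b
  +-cancelʳ-≋ {a} {b} c eq = begin
    a                    ≡⟨ +-identityʳ a ⟨
    a + 0                ≈⟨ +-≋ {a} refl (sym (+-neg c)) ⟩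
    a + (c + neg c)      ≡⟨ +-assoc a c (neg c) ⟨
    a + c + neg c        ≈⟨ +-≋ eq refl ⟩
    b + c + neg c        ≡⟨ +-assoc b c (neg c) ⟩
    b + (c + neg c)      ≈⟨ +-≋ {b} refl (+-neg c) ⟩
    b + 0                ≡⟨ +-identityʳ b ⟩
    b                    ∎
    where open ≋-Reasoning

  offset-zero : ∀ {u e v} → u + e ≋ v → e ≋ 0 → u ≋ v
  offset-zero {u} {e} {v} u+e≋v e≋0 = begin
    u      ≡⟨ +-identityʳ u ⟨
    u + 0  ≈⟨ +-≋ {u} refl (sym e≋0) ⟩
    u + e  ≈⟨ u+e≋v ⟩
    v      ∎
    where open ≋-Reasoning

  offset-pos : ∀ {u e v j} → u + e ≋ v → e ≋ j → u + j ≋ v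
  offset-pos {u} u+e≋v e≋j = trans (+-≋ {u} refl (sym e≋j)) u+e≋v

  offset-neg : ∀ {u e v j} → u + e ≋ v → e + j ≋ 0 → v + j ≋ u
  offset-neg {u} {e} {v} {j} u+e≋v e+j≋0 = begin
    v + j        ≈⟨ +-≋ (sym u+e≋v) refl ⟩
    u + e + j    ≡⟨ +-assoc u e j ⟩
    u + (e + j)  ≈⟨ +-≋ {u} refl e+j≋0 ⟩
    u + 0        ≡⟨ +-identityʳ u ⟩
    u            ∎
    where open ≋-Reasoning

  u+[v−u] : ∀ u v → u + (v + neg u) ≋ v
  u+[v−u] u v = begin
    u + (v + neg u)  ≡⟨ +-comm u (v + neg u) ⟩
    v + neg u + u    ≡⟨ +-assoc v (neg u) u ⟩
    v + (neg u + u)  ≡⟨ cong (v +_) (+-comm (neg u) u) ⟩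
    v + (u + neg u)  ≈⟨ +-≋ {v} refl (+-neg u) ⟩
    v + 0            ≡⟨ +-identityʳ v ⟩
    v                ∎
    where open ≋-Reasoning

  res-≋ : ∀ {a b} → a ≋ b → res p a ≡ res p b
  res-≋ {a} {b} eq = fromℕ<-cong _ _ eq (m%n<n a p) (m%n<n b p)

  negRes-≋ : ∀ {x y} → x + y ≋ 0 → negRes p x ≡ res p y
  negRes-≋ {x} {y} eq = res-≋ (+-cancelʳ-≋ x (begin
    neg x + x   ≡⟨ +-comm (neg x) x ⟩
    x + neg x   ≈⟨ +-neg x ⟩
    0           ≈⟨ sym eq ⟩
    x + y       ≡⟨ +-comm x y ⟩
    y + x       ∎))
    where open ≋-Reasoning

  res-toℕ : (u : Fin p) → res p (toℕ u) ≡ u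
  res-toℕ u = trans (fromℕ<-cong _ _ (m<n⇒m%n≡m (toℕ<n u)) _ (toℕ<n u)) (fromℕ<-toℕ u (toℕ<n u))

data Halving : ℕ → Set where
  even : ∀ c → Halving (2 * c)
  odd  : ∀ c → Halving (1 + 2 * c)

halving : ∀ n → Halving n
halving zero = even 0
halving (suc n) with halving n
... | even c = odd c
... | odd c  = subst Halving (step c) (even (suc c))
  where
    step : ∀ c → 2 * suc c ≡ suc (1 + 2 * c)
    step = solve-∀

prime-odd : ∀ p .{{_ : NonZero p}} → Prime p → 2 < p → p ≡ 1 + 2 * h p
prime-odd p pr 2<p with halving p
... | odd c = cong (λ x → 1 + 2 * x) (sym (trans (cong (_/ 2) (*-comm 2 c)) (m*n/n≡m c 2)))
... | even c with prime⇒irreducible pr (divides c (*-comm 2 c))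
...   | inj₁ ()
...   | inj₂ 2≡p = ⊥-elim (<-irrefl 2≡p 2<p)

filter-head : ∀ {A : Set} {P : Pred A 0ℓ} (P? : Decidable P) {x xs} → x ∈ xs → P x →
              Σ A λ m → Σ (List A) λ rest → (filter P? xs ≡ m ∷ rest) × (m ∈ xs) × P m
filter-head P? {xs = xs} x∈xs px with filter P? xs | ∈-filter⁺ P? x∈xs px | (λ {v} → ∈-filter⁻ P? {v = v} {xs = xs})
... | m ∷ rest | _ | kept⇒member = m , rest , refl , kept⇒member (here refl)

even-mod-2 : ∀ c → (2 * c) % 2 ≡ 0
even-mod-2 c = trans (cong (_% 2) (*-comm 2 c)) (m*n%n≡0 c 2)

odd-mod-2 : ∀ c → (1 + 2 * c) % 2 ≡ 1
odd-mod-2 c = trans (cong (λ z → (1 + z) % 2) (*-comm 2 c)) ([m+kn]%n≡m%n 1 c 2)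

mod-2-step : ∀ n → suc (suc n) % 2 ≡ n % 2
mod-2-step n = trans (cong (_% 2) (+-comm 2 n)) ([m+n]%n≡m%n n 2)

isEven : ℕ → Bool
isEven j = does (j % 2 ≟ 0)

isEven-suc : ∀ j → isEven (suc j) ≡ not (isEven j)
isEven-suc zero = refl
isEven-suc (suc zero) = refl
isEven-suc (suc (suc j)) rewrite mod-2-step (suc j) | mod-2-step j = isEven-suc j

module OddModulus (p : ℕ) .{{_ : NonZero p}} (p-odd : p ≡ 1 + 2 * h p) where
  open Modular p

  H : ℕ
  H = h p

  P U : ℕ → Letter p
  P = plain p
  U = under p

  P-≋ : ∀ {x y} → x ≋ y → P x ≡ P y
  P-≋ = cong inj₁ ∘ res-≋

  U-≋ : ∀ {x y} → x ≋ y → U x ≡ U y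
  U-≋ = cong inj₂ ∘ res-≋

  P-toℕ : ∀ u → P (toℕ u) ≡ inj₁ u
  P-toℕ u = cong inj₁ (res-toℕ u)

  U-toℕ : ∀ u → U (toℕ u) ≡ inj₂ u
  U-toℕ u = cong inj₂ (res-toℕ u)

  2p≡ : 2 * p ≡ 2 + 4 * H
  2p≡ = trans (cong (2 *_) p-odd) (double H)
    where
      double : ∀ H → 2 * (1 + 2 * H) ≡ 2 + 4 * H
      double = solve-∀

  τ : ℕ → Letter p
  τ 0             = t p 2
  τ 1             = t p 1
  τ (suc (suc k)) = t p (3 + k)

  T′-tabulation : T′ p ≡ applyUpTo τ (2 * p)
  T′-tabulation rewrite 2p≡ =
    cong (λ l → t p 2 ∷ t p 1 ∷ l) (map-applyUpTo (suc ∘ suc) (λ k → t p (suc k)) (4 * H))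

  -- Consecutive terms t i, t (i+1) of T are near in T′ (the swap only reverses the first pair).
  T′-consecutive : ∀ i → 0 < i → i < 2 * p → Near (T′ p) (t p i) (t p (suc i))
  T′-consecutive i 0<i i<2p rewrite T′-tabulation = consecutive i 0<i i<2p
    where
      consecutive : ∀ i → 0 < i → i < 2 * p → Near (applyUpTo τ (2 * p)) (t p i) (t p (suc i))
      consecutive 1 _ lt = flip (window τ {m = 0} one lt)
      consecutive 2 _ lt = window τ {m = 0} two lt
      consecutive (suc (suc (suc k))) _ lt =
        subst (λ m → Near (applyUpTo τ (2 * p)) (t p (3 + k)) (t p (3 + m))) (+-comm k 1)
          (window τ {m = 2 + k} one (subst (_< 2 * p) (cong (2 +_) (+-comm 1 k)) lt))

  even-below : ∀ c → 2 * suc c < p → c < H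
  even-below c lt = *-cancelˡ-≤ 2 (s≤s⁻¹ (subst (2 * suc c <_) p-odd lt))

  odd-below : ∀ c → 1 + 2 * c < p → c < H
  odd-below c lt = *-cancelˡ-< 2 c H (s≤s⁻¹ (subst (1 + 2 * c <_) p-odd lt))

  period-fits : ∀ k c → k ≤ 4 → c < H → k + 4 * c < 2 * p
  period-fits k c k≤4 c<H = begin-strict
    k + 4 * c       ≤⟨ +-monoˡ-≤ (4 * c) k≤4 ⟩
    4 + 4 * c       <⟨ m<n+m (4 + 4 * c) {2} (s≤s z≤n) ⟩
    2 + (4 + 4 * c) ≡⟨ shift c ⟩
    2 + 4 * suc c   ≤⟨ +-monoʳ-≤ 2 (*-monoʳ-≤ 4 c<H) ⟩
    2 + 4 * H       ≡⟨ 2p≡ ⟨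
    2 * p           ∎
    where
      open ≤-Reasoning
      shift : ∀ c → 2 + (4 + 4 * c) ≡ 2 + 4 * suc c
      shift = solve-∀

  first-period-fits : ∀ c → c ≤ H → 1 + 4 * c < 2 * p
  first-period-fits c c≤H = subst (1 + 4 * c <_) (sym 2p≡) (s≤s (s≤s (*-monoʳ-≤ 4 c≤H)))

  private
    mod-4 : ∀ r c → r < 4 → (r + 4 * c) % 4 ≡ r
    mod-4 r c r<4 = trans (cong (λ z → (r + z) % 4) (*-comm 4 c)) (trans ([m+kn]%n≡m%n r c 4) (m<n⇒m%n≡m r<4))

    next-period : ∀ c → 4 + 4 * c ≡ 0 + 4 * suc c
    next-period = solve-∀

    half-of-4c : ∀ c → (4 * c) / 2 ≡ 2 * c
    half-of-4c c = trans (cong (_/ 2) (twice c)) (m*n/n≡m (2 * c) 2)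
      where
        twice : ∀ c → 4 * c ≡ 2 * c * 2
        twice = solve-∀

    half-of-4c+4 : ∀ c → (4 + 4 * c) / 2 ≡ 2 + 2 * c
    half-of-4c+4 c = trans (cong (_/ 2) (twice c)) (m*n/n≡m (2 + 2 * c) 2)
      where
        twice : ∀ c → 4 + 4 * c ≡ (2 + 2 * c) * 2
        twice = solve-∀

  t-period₁ : ∀ c {i x} → i ≡ 1 + 4 * c → 2 * c + x ≋ 0 → t p i ≡ U x
  t-period₁ c refl eq rewrite mod-4 1 c (s≤s (s≤s z≤n)) =
    cong inj₂ (trans (cong (negRes p) (half-of-4c c)) (negRes-≋ eq))

  t-period₂ : ∀ c {i x} → i ≡ 2 + 4 * c → 2 * c + x ≋ 0 → t p i ≡ P x
  t-period₂ c refl eq rewrite mod-4 2 c (s≤s (s≤s (s≤s z≤n))) =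
    cong inj₁ (trans (cong (negRes p) (half-of-4c c)) (negRes-≋ eq))

  t-period₃ : ∀ c {i x} → i ≡ 3 + 4 * c → 2 + 2 * c ≋ x → t p i ≡ P x
  t-period₃ c refl eq rewrite mod-4 3 c (s≤s (s≤s (s≤s (s≤s z≤n)))) =
    cong inj₁ (trans (cong (res p) (trans (cong (_/ 2) (+-comm (3 + 4 * c) 1)) (half-of-4c+4 c))) (res-≋ eq))

  t-period₄ : ∀ c {i x} → i ≡ 4 + 4 * c → 2 + 2 * c ≋ x → t p i ≡ U x
  t-period₄ c refl eq rewrite trans (cong (_% 4) (next-period c)) (mod-4 0 (suc c) (s≤s z≤n)) =
    cong inj₂ (trans (cong (res p) (half-of-4c+4 c)) (res-≋ eq))

  pair₁ : ∀ c {x} → c ≤ H → 2 * c + x ≋ 0 → Near (T′ p) (U x) (P x)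
  pair₁ c c≤H x≋−2c = subst₂ (Near (T′ p)) (t-period₁ c refl x≋−2c) (t-period₂ c refl x≋−2c)
    (T′-consecutive (1 + 4 * c) (s≤s z≤n) (first-period-fits c c≤H))

  pair₂ : ∀ c {a b} → c < H → 2 * c + a ≋ 0 → 2 + 2 * c ≋ b → Near (T′ p) (P a) (P b)
  pair₂ c c<H a≋−2c b≋2c+2 = subst₂ (Near (T′ p)) (t-period₂ c refl a≋−2c) (t-period₃ c refl b≋2c+2)
    (T′-consecutive (2 + 4 * c) (s≤s z≤n) (period-fits 2 c (s≤s (s≤s z≤n)) c<H))

  pair₃ : ∀ c {v} → c < H → 2 + 2 * c ≋ v → Near (T′ p) (P v) (U v)
  pair₃ c c<H v≋2c+2 = subst₂ (Near (T′ p)) (t-period₃ c refl v≋2c+2) (t-period₄ c refl v≋2c+2)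
    (T′-consecutive (3 + 4 * c) (s≤s z≤n) (period-fits 3 c (s≤s (s≤s (s≤s z≤n))) c<H))

  pair₄ : ∀ c {a b} → c < H → 2 + 2 * c ≋ a → 2 * suc c + b ≋ 0 → Near (T′ p) (U a) (U b)
  pair₄ c c<H a≋2c+2 b≋−2c−2 = subst₂ (Near (T′ p)) (t-period₄ c refl a≋2c+2) (t-period₁ (suc c) (next c) b≋−2c−2)
    (T′-consecutive (4 + 4 * c) (s≤s z≤n) (period-fits 4 c ≤-refl c<H))
    where
      next : ∀ c → 5 + 4 * c ≡ 1 + 4 * suc c
      next = solve-∀

  complement-odd : ∀ c e → suc c + e ≡ H → (1 + 2 * c) + 2 * suc e ≡ p
  complement-odd c e eq = trans (arith c e) (trans (cong (λ z → 1 + 2 * z) eq) (sym p-odd))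
    where
      arith : ∀ c e → (1 + 2 * c) + 2 * suc e ≡ 1 + 2 * (suc c + e)
      arith = solve-∀

  complement-even : ∀ c e → suc c + e ≡ H → 2 * suc c + (1 + 2 * e) ≡ p
  complement-even c e eq = trans (arith c e) (trans (cong (λ z → 1 + 2 * z) eq) (sym p-odd))
    where
      arith : ∀ c e → 2 * suc c + (1 + 2 * e) ≡ 1 + 2 * (suc c + e)
      arith = solve-∀

  twins : ∀ v → Near (T′ p) (P v) (U v)
  twins v = subst₂ (Near (T′ p)) (P-≋ (%-≋ v)) (U-≋ (%-≋ v))
    (twins-residue (halving (v % p)) (m%n<n v p))
    where
      twins-residue : ∀ {w} → Halving w → w < p → Near (T′ p) (P w) (U w)
      twins-residue (even zero)    _  = flip (pair₁ 0 z≤n refl)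
      twins-residue (even (suc c)) lt = pair₃ c (even-below c lt) (≡⇒≋ (twice-suc c))
        where
          twice-suc : ∀ c → 2 + 2 * c ≡ 2 * suc c
          twice-suc = solve-∀
      twins-residue (odd c) lt with m≤n⇒∃[o]m+o≡n (odd-below c lt)
      ... | e , eq = flip (pair₁ (suc e) (subst (suc e ≤_) eq (s≤s (m≤n+m e c)))
        (trans (≡⇒≋ (trans (+-comm (2 * suc e) (1 + 2 * c)) (complement-odd c e eq))) p≋0))

  Straddle : ℕ → ℕ → ℕ → ℕ → Set
  Straddle m j a b = (a + j ≋ m) × (m + j ≋ b)

  ≋-shift : ∀ {j k x y} → j + k ≡ p → x + j ≋ y → y + k ≋ x
  ≋-shift {j} {k} {x} {y} j+k≡p x+j≋y = begin
    y + k        ≈⟨ +-≋ (sym x+j≋y) refl ⟩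
    x + j + k    ≡⟨ +-assoc x j k ⟩
    x + (j + k)  ≡⟨ cong (x +_) j+k≡p ⟩
    x + p        ≈⟨ +-≋ {x} refl p≋0 ⟩
    x + 0        ≡⟨ +-identityʳ x ⟩
    x            ∎
    where open ≋-Reasoning

  straddle-reflect : ∀ {m j k a b} → j + k ≡ p → Straddle m j a b → Straddle m k b a
  straddle-reflect j+k≡p (a+j≋m , m+j≋b) = ≋-shift j+k≡p m+j≋b , ≋-shift j+k≡p a+j≋m

  crossing : ∀ {j a b} → 0 < j → j < p → Straddle 1 j a b → Near (T′ p) (P a) (P b)
  crossing {j} 0<j j<p = by-parity (halving j) 0<j j<p
    where
      odd-step : ∀ c {a b} → c < H → Straddle 1 (1 + 2 * c) a b → Near (T′ p) (P a) (P b)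
      odd-step c {a} c<H (a+j≋1 , 1+j≋b) = pair₂ c c<H (+-cancelʳ-≋ 1 a+2c+1≋1) 1+j≋b
        where
          reorder : ∀ a c → 2 * c + a + 1 ≡ a + (1 + 2 * c)
          reorder = solve-∀
          a+2c+1≋1 : 2 * c + a + 1 ≋ 0 + 1
          a+2c+1≋1 = trans (≡⇒≋ (reorder a c)) a+j≋1

      by-parity : ∀ {j a b} → Halving j → 0 < j → j < p → Straddle 1 j a b → Near (T′ p) (P a) (P b)
      by-parity (odd c)  _ lt s = odd-step c (odd-below c lt) s
      by-parity (even (suc c)) _ lt s with m≤n⇒∃[o]m+o≡n (even-below c lt)
      ... | e , eq = flip (odd-step e (subst (e <_) eq (s≤s (m≤n+m e c))) (straddle-reflect (complement-even c e eq) s))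

  wrap : ∀ {j a b} → 0 < j → j < p → Straddle 0 j a b → Near (T′ p) (U a) (U b)
  wrap {j} 0<j j<p = by-parity (halving j) 0<j j<p
    where
      even-step : ∀ c {a b} → c < H → Straddle 0 (2 * suc c) a b → Near (T′ p) (U a) (U b)
      even-step c {a} c<H (a+j≋0 , j≋b) =
        flip (pair₄ c c<H (trans (≡⇒≋ (twice-suc c)) j≋b) (trans (≡⇒≋ (+-comm (2 * suc c) a)) a+j≋0))
        where
          twice-suc : ∀ c → 2 + 2 * c ≡ 2 * suc c
          twice-suc = solve-∀

      by-parity : ∀ {j a b} → Halving j → 0 < j → j < p → Straddle 0 j a b → Near (T′ p) (U a) (U b)
      by-parity (even (suc c)) _ lt s = even-step c (even-below c lt) s
      by-parity (odd c) _ lt s with m≤n⇒∃[o]m+o≡n (odd-below c lt)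
      ... | e , eq = flip (even-step e (subst (e <_) eq (s≤s (m≤n+m e c))) (straddle-reflect (complement-odd c e eq) s))

  length-T′ : length (T′ p) ≡ 2 * p
  length-T′ = trans (cong length T′-tabulation) (length-applyUpTo τ (2 * p))

  T′-starts : Starts (P 0) (T′ p)
  T′-starts rewrite T′-tabulation | 2p≡ =
    applyUpTo (τ ∘ suc) (suc (4 * H)) , cong (_∷ applyUpTo (τ ∘ suc) (suc (4 * H))) (t-period₂ 0 refl refl)

module PrimeModulus (p : ℕ) .{{_ : NonZero p}} (p-prime : Prime p) (2<p : 2 < p) where
  open Modular p

  p-odd : p ≡ 1 + 2 * h p
  p-odd = prime-odd p p-prime 2<p

  open OddModulus p p-odd

  1%p≡1 : 1 % p ≡ 1
  1%p≡1 = m<n⇒m%n≡m (≤-trans (s≤s (s≤s z≤n)) (<⇒≤ 2<p))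

  H<p : H < p
  H<p = subst (H <_) (sym p-odd) (s≤s (m≤m+n H (H + 0)))

  minus-one : ∀ a → 1 + a ≋ 0 → (p ∸ 1) * a ≋ 1
  minus-one a 1+a≋0 = +-cancelʳ-≋ a (begin
    (p ∸ 1) * a + a  ≡⟨ cong ((p ∸ 1) * a +_) (sym (*-identityˡ a)) ⟩
    (p ∸ 1) * a + 1 * a ≡⟨ *-distribʳ-+ a (p ∸ 1) 1 ⟨
    (p ∸ 1 + 1) * a  ≡⟨ cong (_* a) (m∸n+n≡m (≤-trans (s≤s z≤n) 2<p)) ⟩
    p * a            ≡⟨ *-comm p a ⟩
    a * p            ≈⟨ *p≋0 a ⟩
    0                ≈⟨ sym 1+a≋0 ⟩
    1 + a            ∎)
    where open ≋-Reasoning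

  inverse : ∀ {j} → 0 < j → j < p → Σ ℕ λ w → w * j ≋ 1
  inverse {suc j} _ j<p with coprime-Bézout (prime⇒coprime p-prime j<p)
  ... | Bézout.+- x y 1+yj≡xp = (p ∸ 1) * y , trans (≡⇒≋ (*-assoc (p ∸ 1) y (suc j)))
          (minus-one (y * suc j) (trans (≡⇒≋ 1+yj≡xp) (*p≋0 x)))
  ... | Bézout.-+ x y 1+xp≡yj = y , (begin
          y * suc j   ≡⟨ 1+xp≡yj ⟨
          1 + x * p   ≈⟨ +-≋ {1} refl (*p≋0 x) ⟩
          1           ∎)
    where open ≋-Reasoning

  reduced-multiplier : ∀ a q {m j x} → a + 2 * q ≋ m → m * j ≋ x →
                       Σ ℕ λ q′ → q′ < p × (a + 2 * q′) * j ≋ x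
  reduced-multiplier a q {m} {j} {x} a+2q≋m mj≋x = q % p , m%n<n q p , (begin
    (a + 2 * (q % p)) * j  ≈⟨ *-≋ (+-≋ {a} refl (*-≋ {2} refl (%-≋ q))) refl ⟩
    (a + 2 * q) * j        ≈⟨ *-≋ a+2q≋m refl ⟩
    m * j                  ≈⟨ mj≋x ⟩
    x                      ∎)
    where open ≋-Reasoning

  -- 2(h + 1) = p + 1 acts as 1, and 1 + 2h = p as 0.
  twice-suc-h : ∀ m → 0 + 2 * (suc H * m) ≋ m
  twice-suc-h m = begin
    2 * (suc H * m)       ≡⟨ arith H m ⟩
    (1 + 2 * H) * m + m   ≡⟨ cong (λ z → z * m + m) p-odd ⟨
    p * m + m             ≈⟨ +-≋ (trans (≡⇒≋ (*-comm p m)) (*p≋0 m)) refl ⟩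
    m                     ∎
    where
      open ≋-Reasoning
      arith : ∀ H m → 2 * (suc H * m) ≡ (1 + 2 * H) * m + m
      arith = solve-∀

  odd-shift : ∀ m → 1 + 2 * (H + suc H * m) ≋ m
  odd-shift m = begin
    1 + 2 * (H + suc H * m)   ≡⟨ arith H m ⟩
    (1 + 2 * H) + 2 * (suc H * m) ≡⟨ cong (_+ 2 * (suc H * m)) p-odd ⟨
    p + 2 * (suc H * m)       ≈⟨ +-≋ p≋0 (twice-suc-h m) ⟩
    m                         ∎
    where
      open ≋-Reasoning
      arith : ∀ H m → 1 + 2 * (H + suc H * m) ≡ (1 + 2 * H) + 2 * (suc H * m)
      arith = solve-∀

  module Multipliers {j} (0<j : 0 < j) (j<p : j < p) where
    private
      w : ℕ
      w = proj₁ (inverse 0<j j<p)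

      scaled : ∀ x → w * x * j ≋ x
      scaled x = begin
        w * x * j    ≡⟨ arith w x j ⟩
        x * (w * j)  ≈⟨ *-≋ {x} refl (proj₂ (inverse 0<j j<p)) ⟩
        x * 1        ≡⟨ *-identityʳ x ⟩
        x            ∎
        where
          open ≋-Reasoning
          arith : ∀ w x j → w * x * j ≡ x * (w * j)
          arith = solve-∀

    even-multiplier : ∀ x → Σ ℕ λ q → q < p × 2 * q * j ≋ x
    even-multiplier x = reduced-multiplier 0 (suc H * (w * x)) (twice-suc-h (w * x)) (scaled x)

    odd-multiplier : ∀ x → Σ ℕ λ q → q < p × (1 + 2 * q) * j ≋ x
    odd-multiplier x = reduced-multiplier 1 (H + suc H * (w * x)) (odd-shift (w * x)) (scaled x)

  open Multipliers

  odd∈odds : ∀ {q} → q < p → 1 + 2 * q ∈ odds p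
  odd∈odds {q} q<p = subst (_∈ odds p) (+-comm (2 * q) 1) (∈-map⁺ (λ k → 2 * k + 1) (∈-upTo⁺ q<p))

  r-spec : ∀ {j} → 0 < j → j < p → Σ ℕ λ q → q < p × (r p j ≡ 1 + 2 * q) × ((1 + 2 * q) * j ≋ 1)
  r-spec {j} 0<j j<p with odd-multiplier 0<j j<p 1
  ... | q , q<p , qj≋1 with filter-head (λ m → (m * j) % p ≟ 1) (odd∈odds q<p) (trans qj≋1 1%p≡1)
  ... | m , rest , kept , m∈odds , mj≡1 with ∈-map⁻ (λ k → 2 * k + 1) m∈odds
  ... | k , k∈upTo , refl =
        k , ∈-upTo⁻ k∈upTo , trans (first-kept kept) (+-comm (2 * k) 1) ,
        trans (cong (λ z → (z * j) % p) (+-comm 1 (2 * k))) (trans mj≡1 (sym 1%p≡1))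
    where
      first-kept : ∀ {m rest} → filter (λ m → (m * j) % p ≟ 1) (odds p) ≡ m ∷ rest → r p j ≡ m
      first-kept kept rewrite kept = refl

  xj-even : ∀ j q {m y} → m ≡ 2 * q → 2 * q * j ≋ y → xj p j m ≡ P y
  xj-even j q refl eq rewrite even-mod-2 q = cong inj₁ (res-≋ eq)

  xj-odd : ∀ j q {m y} → m ≡ 1 + 2 * q → (1 + 2 * q) * j ≋ y → xj p j m ≡ U y
  xj-odd j q refl eq rewrite odd-mod-2 q = cong inj₂ (res-≋ eq)

  I′-form : ∀ j → I′ p j ≡ applyUpTo (xj p j) (r p j)
  I′-form j = map-applyUpTo id (xj p j) (r p j)

  I″-form : ∀ j → I″ p j ≡ applyUpTo (λ k → xj p j (r p j + k)) (2 * p ∸ r p j)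
  I″-form j = map-applyUpTo id (λ k → xj p j (r p j + k)) (2 * p ∸ r p j)

  odd<2p : ∀ q → q < p → 1 + 2 * q < 2 * p
  odd<2p q q<p = ≤-trans (≤-reflexive (twice-suc q)) (*-monoʳ-≤ 2 q<p)
    where
      twice-suc : ∀ q → 2 + 2 * q ≡ 2 * suc q
      twice-suc = solve-∀

  r<2p : ∀ {j} → 0 < j → j < p → r p j < 2 * p
  r<2p 0<j j<p = let q , q<p , r≡ , _ = r-spec 0<j j<p in subst (_< 2 * p) (sym r≡) (odd<2p q q<p)

  x-r : ∀ {j} → 0 < j → j < p → xj p j (r p j) ≡ U 1
  x-r {j} 0<j j<p = let q , _ , r≡ , qj≋1 = r-spec 0<j j<p in xj-odd j q {y = 1} r≡ qj≋1

  I′-starts : ∀ {j} → 0 < j → j < p → Starts (P 0) (I′ p j)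
  I′-starts {j} 0<j j<p = subst (Starts (P 0)) (sym (I′-form j)) (applyUpTo-starts (xj p j) 0<r)
    where
      0<r : 0 < r p j
      0<r = let _ , _ , r≡ , _ = r-spec 0<j j<p in subst (0 <_) (sym r≡) (s≤s z≤n)

  I″-starts : ∀ {j} → 0 < j → j < p → Starts (U 1) (I″ p j)
  I″-starts {j} 0<j j<p = subst₂ Starts (trans (cong (xj p j) (+-identityʳ (r p j))) (x-r 0<j j<p)) (sym (I″-form j))
    (applyUpTo-starts (λ k → xj p j (r p j + k)) (m<n⇒0<n∸m (r<2p 0<j j<p)))

  IT′-blocks : IT′ p ≡ (rising (J p) H ++ falling (Ĵ p) H) ++ T′ p
  IT′-blocks = cong₂ (λ a b → (a ++ b) ++ T′ p)
    (trans (cong (concat ∘ map (J p)) oneToH≡) (rising-concat (J p) H))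
    (trans (cong (concat ∘ map (Ĵ p) ∘ reverse) oneToH≡)
      (trans (cong (concat ∘ map (Ĵ p)) (reverse-applyUpTo suc H)) (falling-concat (Ĵ p) H)))
    where
      oneToH≡ : oneToH p ≡ applyUpTo suc H
      oneToH≡ = map-applyUpTo id suc H

  in-T′ : ∀ {a b} → Near (T′ p) a b → Near (IT′ p) a b
  in-T′ = near-infix (infix-suffix (I p) (T′ p))

  in-runs : ∀ {s} → Infix s (rising (J p) H ++ falling (Ĵ p) H) → Infix s (IT′ p)
  in-runs i = subst (Infix _) (sym IT′-blocks) (infix-++ʳ (T′ p) i)

  headJ headĴ : ℕ → Letter p
  headJ j = if isEven j then U 1 else P 0
  headĴ j = if isEven j then P 0 else U 1

  -- Parities alternate, so J_{j+1} begins like Ĵ_j.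
  headJ-suc : ∀ j → headJ (suc j) ≡ headĴ j
  headJ-suc j rewrite isEven-suc j with isEven j
  ... | true  = refl
  ... | false = refl

  J-starts : ∀ {j} → 0 < j → j < p → Starts (headJ j) (J p j)
  J-starts {j} 0<j j<p = by-parity (isEven j)
    where
      by-parity : ∀ b → Starts (if b then U 1 else P 0) (if b then I″ p j else I′ p j)
      by-parity true  = I″-starts 0<j j<p
      by-parity false = I′-starts 0<j j<p

  Ĵ-starts : ∀ {j} → 0 < j → j < p → Starts (headĴ j) (Ĵ p j)
  Ĵ-starts {j} 0<j j<p = by-parity (isEven j)
    where
      by-parity : ∀ b → Starts (if b then P 0 else U 1) (if b then I′ p j else I″ p j)
      by-parity true  = I′-starts 0<j j<p
      by-parity false = I″-starts 0<j j<p

  -- In IT′ each block is followed by the first letter of the other half of its row: J_j by J_{j+1}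
  -- (or Ĵ_h when j = h), and Ĵ_j by Ĵ_{j−1} (or T′ when j = 1).
  J-followed : ∀ {j} → 0 < j → j ≤ H → Infix (J p j ++ [ headĴ j ]) (IT′ p)
  J-followed {suc i} _ j≤H with m≤n⇒m<n∨m≡n j≤H
  ... | inj₁ j<H = followed-by
        (subst (λ x → Starts x (J p (suc (suc i)))) (headJ-suc (suc i)) (J-starts (s≤s z≤n) (≤-<-trans j<H H<p)))
        (in-runs (infix-++ʳ (falling (Ĵ p) H) (rising-adjacent (J p) j<H)))
  ... | inj₂ j≡H = followed-by (Ĵ-starts (s≤s z≤n) (≤-<-trans j≤H H<p))
        (in-runs (subst (λ n → Infix (J p n ++ Ĵ p n) (rising (J p) H ++ falling (Ĵ p) H)) (sym j≡H)
          (rising-falling-meet (J p) (Ĵ p) (subst (0 <_) j≡H (s≤s z≤n)))))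

  Ĵ-followed : ∀ {j} → 0 < j → j ≤ H → Infix (Ĵ p j ++ [ headJ j ]) (IT′ p)
  Ĵ-followed {suc zero} _ 1≤H = followed-by T′-starts
    (subst (Infix (Ĵ p 1 ++ T′ p)) (sym (trans IT′-blocks (++-assoc (rising (J p) H) _ (T′ p))))
      (infix-trans (falling-then (Ĵ p) (T′ p) 1≤H) (infix-suffix (rising (J p) H) _)))
  Ĵ-followed {suc (suc i)} _ j≤H = followed-by
    (subst (λ x → Starts x (Ĵ p (suc i))) (sym (headJ-suc (suc i))) (Ĵ-starts (s≤s z≤n) (<-trans (s≤s ≤-refl) (≤-<-trans j≤H H<p))))
    (in-runs (infix-trans (falling-adjacent (Ĵ p) j≤H) (infix-suffix (rising (J p) H) _)))

  module Row {j} (0<j : 0 < j) (j≤H : j ≤ H) where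
    j<p : j < p
    j<p = ≤-<-trans j≤H H<p

    halves-followed : Infix (I′ p j ++ [ U 1 ]) (IT′ p) × Infix (I″ p j ++ [ P 0 ]) (IT′ p)
    halves-followed = by-parity (isEven j) (J-followed 0<j j≤H) (Ĵ-followed 0<j j≤H)
      where
        by-parity : ∀ b → Infix ((if b then I″ p j else I′ p j) ++ [ if b then P 0 else U 1 ]) (IT′ p)
                        → Infix ((if b then I′ p j else I″ p j) ++ [ if b then U 1 else P 0 ]) (IT′ p)
                        → Infix (I′ p j ++ [ U 1 ]) (IT′ p) × Infix (I″ p j ++ [ P 0 ]) (IT′ p)
        by-parity true  Jj Ĵj = Ĵj , Jj
        by-parity false Jj Ĵj = Jj , Ĵj

    -- Together with the letter after it, each half is a stretch of the row: x₀ ⋯ x_r and x_r ⋯ x_{2p}.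
    first-stretch : Infix (applyUpTo (xj p j) (suc (r p j))) (IT′ p)
    first-stretch = subst (λ l → Infix l (IT′ p)) (begin
      I′ p j ++ [ U 1 ]                                 ≡⟨ cong₂ (λ l x → l ++ [ x ]) (I′-form j) (sym (x-r 0<j j<p)) ⟩
      applyUpTo (xj p j) (r p j) ++ [ xj p j (r p j) ]  ≡⟨ applyUpTo-∷ʳ (xj p j) (r p j) ⟩
      applyUpTo (xj p j) (suc (r p j))                  ∎)
      (proj₁ halves-followed)
      where open ≡-Reasoning

    second-stretch : Infix (applyUpTo (λ k → xj p j (r p j + k)) (suc (2 * p ∸ r p j))) (IT′ p)
    second-stretch = subst (λ l → Infix l (IT′ p)) (begin
      I″ p j ++ [ P 0 ]                        ≡⟨ cong₂ (λ l x → l ++ [ x ]) (I″-form j) (sym x-2p) ⟩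
      applyUpTo x″ (2 * p ∸ r p j) ++ [ x″ (2 * p ∸ r p j) ] ≡⟨ applyUpTo-∷ʳ x″ (2 * p ∸ r p j) ⟩
      applyUpTo x″ (suc (2 * p ∸ r p j))       ∎)
      (proj₂ halves-followed)
      where
        open ≡-Reasoning
        x″ : ℕ → Letter p
        x″ k = xj p j (r p j + k)
        x-2p : x″ (2 * p ∸ r p j) ≡ P 0
        x-2p = xj-even j p (m+[n∸m]≡n (<⇒≤ (r<2p 0<j j<p)))
          (trans (≡⇒≋ (arith p j)) (*p≋0 (2 * j)))
          where
            arith : ∀ p j → 2 * p * j ≡ 2 * j * p
            arith = solve-∀

    near-in-first : ∀ {m d} → Gap d → m + d ≤ r p j → Near (IT′ p) (xj p j m) (xj p j (m + d))
    near-in-first g m+d≤r = near-infix first-stretch (window (xj p j) g (s≤s m+d≤r))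

    near-in-second : ∀ {m d} → Gap d → r p j ≤ m → m + d ≤ 2 * p → Near (IT′ p) (xj p j m) (xj p j (m + d))
    near-in-second {m} g r≤m m+d≤2p = let k , r+k≡m = m≤n⇒∃[o]m+o≡n r≤m in at-offset k g r+k≡m m+d≤2p
      where
        at-offset : ∀ k {m d} → Gap d → r p j + k ≡ m → m + d ≤ 2 * p →
                    Near (IT′ p) (xj p j m) (xj p j (m + d))
        at-offset k {d = d} g refl m+d≤2p =
          subst (Near (IT′ p) (xj p j (r p j + k)) ∘ xj p j) (sym (+-assoc (r p j) k d))
            (near-infix second-stretch (window (λ k → xj p j (r p j + k)) g (s≤s (m+n≤o⇒m≤o∸n (k + d)
              (subst (_≤ 2 * p) (arith (r p j) k d) m+d≤2p)))))
          where
            arith : ∀ r k d → r + k + d ≡ k + d + r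
            arith = solve-∀

    -- The pair x_{r−1}, x_{r+1} straddles the cut: it is  1 − j, 1 + j  and is found in T′.
    across-cut : ∀ {m} → r p j ≡ m + 1 → Near (IT′ p) (xj p j m) (xj p j (m + 2))
    across-cut {m} r≡m+1 = let q , _ , r≡ , qj≋1 = r-spec 0<j j<p in
      cut q (suc-injective (trans (+-comm 1 m) (trans (sym r≡m+1) r≡))) qj≋1
      where
        cut : ∀ q {m} → m ≡ 2 * q → (1 + 2 * q) * j ≋ 1 → Near (IT′ p) (xj p j m) (xj p j (m + 2))
        cut q refl qj≋1 = subst₂ (Near (IT′ p))
          (sym (xj-even j q refl refl)) (sym (xj-even j (suc q) (arith₁ q) refl))
          (in-T′ (crossing 0<j j<p (trans (≡⇒≋ (arith₂ q j)) qj≋1 ,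
                                    sym (trans (≡⇒≋ (arith₃ q j)) (+-≋ qj≋1 refl)))))
          where
            arith₁ : ∀ q → 2 * q + 2 ≡ 2 * suc q
            arith₁ = solve-∀
            arith₂ : ∀ q j → 2 * q * j + j ≡ (1 + 2 * q) * j
            arith₂ = solve-∀
            arith₃ : ∀ q j → 2 * suc q * j ≡ (1 + 2 * q) * j + j
            arith₃ = solve-∀

    -- The pair x_{2p−1}, x_{2p+1} wraps around the row: it is  −j̲, j̲  and is found in T′.
    across-end : ∀ {m} → m + 1 ≡ 2 * p → Near (IT′ p) (xj p j m) (xj p j (m + 2))
    across-end {m} m+1≡2p =
      end (suc-injective (trans (+-comm 1 m) (trans m+1≡2p (trans (cong (2 *_) (sym (suc-pred p))) (arith₁ (pred p))))))
      where
        arith₁ : ∀ n → 2 * suc n ≡ suc (1 + 2 * n)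
        arith₁ = solve-∀
        end : ∀ {m} → m ≡ 1 + 2 * pred p → Near (IT′ p) (xj p j m) (xj p j (m + 2))
        end refl = subst₂ (Near (IT′ p))
          (sym (xj-odd j (pred p) refl refl))
          (sym (xj-odd j p (trans (arith₂ (pred p)) (cong (λ n → 1 + 2 * n) (suc-pred p))) refl))
          (in-T′ (wrap 0<j j<p
            (trans (≡⇒≋ (trans (arith₃ (pred p) j) (cong (λ n → 2 * j * n) (suc-pred p)))) (*p≋0 (2 * j)) ,
             sym (trans (≡⇒≋ (arith₄ p j)) (trans (+-≋ {j} refl (*p≋0 (2 * j))) (≡⇒≋ (+-identityʳ j)))))))
          where
            arith₂ : ∀ n → 1 + 2 * n + 2 ≡ 1 + 2 * suc n
            arith₂ = solve-∀
            arith₃ : ∀ n j → (1 + 2 * n) * j + j ≡ 2 * j * suc n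
            arith₃ = solve-∀
            arith₄ : ∀ p j → (1 + 2 * p) * j ≡ j + 2 * j * p
            arith₄ = solve-∀

    row-step₁ : ∀ m → m < 2 * p → Near (IT′ p) (xj p j m) (xj p j (m + 1))
    row-step₁ m m<2p with ≤-<-connex (m + 1) (r p j)
    ... | inj₁ m+1≤r = near-in-first one m+1≤r
    ... | inj₂ r<m+1 = near-in-second one (≤-pred (subst (r p j <_) (+-comm m 1) r<m+1))
                                         (subst (_≤ 2 * p) (+-comm 1 m) m<2p)

    row-step₂ : ∀ m → m < 2 * p → Near (IT′ p) (xj p j m) (xj p j (m + 2))
    row-step₂ m m<2p with ≤-<-connex (m + 2) (r p j)
    ... | inj₁ m+2≤r = near-in-first two m+2≤r
    ... | inj₂ r<m+2 with m≤n⇒m<n∨m≡n (≤-pred (subst (r p j <_) (+-comm m 2) r<m+2))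
    ...   | inj₂ r≡m+1 = across-cut (trans r≡m+1 (+-comm 1 m))
    ...   | inj₁ r≤m with ≤-<-connex (m + 2) (2 * p)
    ...     | inj₁ m+2≤2p = near-in-second two (≤-pred r≤m) m+2≤2p
    ...     | inj₂ 2p<m+2 = across-end (≤-antisym (subst (_≤ 2 * p) (+-comm 1 m) m<2p)
                                                   (subst (2 * p ≤_) (+-comm 1 m) (≤-pred (subst (2 * p <_) (+-comm m 2) 2p<m+2))))

    plain-step : ∀ x → Near (IT′ p) (P x) (U (x + j))
    plain-step x = let q , q<p , 2qj≋x = even-multiplier 0<j j<p x in
      subst₂ (Near (IT′ p))
        (xj-even j q refl 2qj≋x)
        (xj-odd j q (+-comm (2 * q) 1) (trans (≡⇒≋ (+-comm j (2 * q * j))) (+-≋ 2qj≋x refl)))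
        (row-step₁ (2 * q) (*-monoʳ-< 2 q<p))

    under-step : ∀ x → Near (IT′ p) (U x) (P (x + j))
    under-step x = let q , q<p , qj≋x = odd-multiplier 0<j j<p x in
      subst₂ (Near (IT′ p))
        (xj-odd j q refl qj≋x)
        (xj-even j (suc q) (arith₁ q) (trans (≡⇒≋ (arith₂ q j)) (+-≋ qj≋x refl)))
        (row-step₁ (1 + 2 * q) (odd<2p q q<p))
      where
        arith₁ : ∀ q → 1 + 2 * q + 1 ≡ 2 * suc q
        arith₁ = solve-∀
        arith₂ : ∀ q j → 2 * suc q * j ≡ (1 + 2 * q) * j + j
        arith₂ = solve-∀

    plain-step₂ : ∀ x → Near (IT′ p) (P x) (P (x + 2 * j))
    plain-step₂ x = let q , q<p , 2qj≋x = even-multiplier 0<j j<p x in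
      subst₂ (Near (IT′ p))
        (xj-even j q refl 2qj≋x)
        (xj-even j (suc q) (arith₁ q) (trans (≡⇒≋ (arith₂ q j)) (+-≋ 2qj≋x refl)))
        (row-step₂ (2 * q) (*-monoʳ-< 2 q<p))
      where
        arith₁ : ∀ q → 2 * q + 2 ≡ 2 * suc q
        arith₁ = solve-∀
        arith₂ : ∀ q j → 2 * suc q * j ≡ 2 * q * j + 2 * j
        arith₂ = solve-∀

    under-step₂ : ∀ x → Near (IT′ p) (U x) (U (x + 2 * j))
    under-step₂ x = let q , q<p , qj≋x = odd-multiplier 0<j j<p x in
      subst₂ (Near (IT′ p))
        (xj-odd j q refl qj≋x)
        (xj-odd j (suc q) (arith₁ q) (trans (≡⇒≋ (arith₂ q j)) (+-≋ qj≋x refl)))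
        (row-step₂ (1 + 2 * q) (odd<2p q q<p))
      where
        arith₁ : ∀ q → 1 + 2 * q + 2 ≡ 1 + 2 * suc q
        arith₁ = solve-∀
        arith₂ : ∀ q j → (1 + 2 * suc q) * j ≡ (1 + 2 * q) * j + 2 * j
        arith₂ = solve-∀

  open Row

  signed-residue : ∀ e → (e ≋ 0) ⊎ Σ ℕ λ j → 0 < j × j ≤ H × ((e ≋ j) ⊎ (e + j ≋ 0))
  signed-residue e = classify (e % p) (m%n<n e p) (sym (%-≋ e))
    where
      classify : ∀ w → w < p → e ≋ w → (e ≋ 0) ⊎ Σ ℕ λ j → 0 < j × j ≤ H × ((e ≋ j) ⊎ (e + j ≋ 0))
      classify zero _ e≋0 = inj₁ e≋0
      classify (suc w) w<p e≋w with ≤-<-connex (suc w) H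
      ... | inj₁ w≤H = inj₂ (suc w , s≤s z≤n , w≤H , inj₁ e≋w)
      ... | inj₂ H<w = inj₂ (p ∸ suc w , m<n⇒0<n∸m w<p , complement≤H ,
                             inj₂ (trans (+-≋ e≋w refl) (trans (≡⇒≋ (m+[n∸m]≡n (<⇒≤ w<p))) p≋0)))
        where
          complement≤H : p ∸ suc w ≤ H
          complement≤H = ≤-trans (∸-monoʳ-≤ p H<w)
            (≤-reflexive (trans (cong (_∸ suc H) (trans p-odd (split H))) (m+n∸m≡n (suc H) H)))
            where
              split : ∀ H → 1 + 2 * H ≡ suc H + H
              split = solve-∀

  plain-under : ∀ u v → Near (IT′ p) (P u) (U v)
  plain-under u v with signed-residue (v + neg u)
  ... | inj₁ e≋0 = subst (Near (IT′ p) (P u)) (U-≋ (offset-zero {u} {v + neg u} {v} (u+[v−u] u v) e≋0)) (in-T′ (twins u))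
  ... | inj₂ (j , 0<j , j≤H , inj₁ e≋j) =
        subst (Near (IT′ p) (P u)) (U-≋ (offset-pos {u} {v + neg u} {v} {j} (u+[v−u] u v) e≋j)) (plain-step 0<j j≤H u)
  ... | inj₂ (j , 0<j , j≤H , inj₂ e+j≋0) =
        flip (subst (Near (IT′ p) (U v)) (P-≋ (offset-neg {u} {v + neg u} {v} {j} (u+[v−u] u v) e+j≋0)) (under-step 0<j j≤H v))

  same-kind : (F : ℕ → Letter p) → (∀ {x y} → x ≋ y → F x ≡ F y) →
              (∀ {j} → 0 < j → j ≤ H → ∀ x → Near (IT′ p) (F x) (F (x + 2 * j))) →
              (∀ x → Close (IT′ p) (F x) (F x)) → ∀ u v → Close (IT′ p) (F u) (F v)
  same-kind F F-≋ step₂ occurs u v = by-sign (signed-residue e)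
    where
      e : ℕ
      e = suc H * (v + neg u)
      u+2e≋v : u + 2 * e ≋ v
      u+2e≋v = trans (+-≋ {u} refl (twice-suc-h (v + neg u))) (u+[v−u] u v)
      by-sign : (e ≋ 0) ⊎ Σ ℕ (λ j → 0 < j × j ≤ H × ((e ≋ j) ⊎ (e + j ≋ 0))) → Close (IT′ p) (F u) (F v)
      by-sign (inj₁ e≋0) = subst (Close (IT′ p) (F u)) (F-≋ (offset-zero {u} {2 * e} {v} u+2e≋v (*-≋ {2} refl e≋0))) (occurs u)
      by-sign (inj₂ (j , 0<j , j≤H , inj₁ e≋j)) =
        near⇒close (subst (Near (IT′ p) (F u)) (F-≋ (offset-pos {u} {2 * e} {v} {2 * j} u+2e≋v (*-≋ {2} refl e≋j))) (step₂ 0<j j≤H u))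
      by-sign (inj₂ (j , 0<j , j≤H , inj₂ e+j≋0)) =
        near⇒close (flip (subst (Near (IT′ p) (F v)) (F-≋ (offset-neg {u} {2 * e} {v} {2 * j} u+2e≋v 2e+2j≋0)) (step₂ 0<j j≤H v)))
        where
          2e+2j≋0 : 2 * e + 2 * j ≋ 0
          2e+2j≋0 = trans (≡⇒≋ (sym (*-distribˡ-+ 2 e j))) (*-≋ {2} refl e+j≋0)

  2-radius : Is2Radius (IT′ p)
  2-radius (inj₁ u) (inj₁ v) = subst₂ (Close (IT′ p)) (P-toℕ u) (P-toℕ v)
    (same-kind P P-≋ plain-step₂ (λ x → close-refl {s = IT′ p} (near⇒close (in-T′ (twins x)))) (toℕ u) (toℕ v))
  2-radius (inj₂ u) (inj₂ v) = subst₂ (Close (IT′ p)) (U-toℕ u) (U-toℕ v)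
    (same-kind U U-≋ under-step₂ (λ x → close-refl {s = IT′ p} (near⇒close (in-T′ (flip (twins x))))) (toℕ u) (toℕ v))
  2-radius (inj₁ u) (inj₂ v) = near⇒close (subst₂ (Near (IT′ p)) (P-toℕ u) (U-toℕ v)
    (plain-under (toℕ u) (toℕ v)))
  2-radius (inj₂ u) (inj₁ v) = near⇒close (subst₂ (Near (IT′ p)) (U-toℕ u) (P-toℕ v)
    (flip (plain-under (toℕ v) (toℕ u))))

  row-length : ∀ {j} → 0 < j → j < p → length (J p j) + length (Ĵ p j) ≡ 2 * p
  row-length {j} 0<j j<p = by-parity (isEven j)
    where
      halves : length (I′ p j) + length (I″ p j) ≡ 2 * p
      halves = begin
        length (I′ p j) + length (I″ p j)
          ≡⟨ cong₂ _+_ (trans (cong length (I′-form j)) (length-applyUpTo _ (r p j)))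
                       (trans (cong length (I″-form j)) (length-applyUpTo _ (2 * p ∸ r p j))) ⟩
        r p j + (2 * p ∸ r p j) ≡⟨ m+[n∸m]≡n (<⇒≤ (r<2p 0<j j<p)) ⟩
        2 * p                   ∎
        where open ≡-Reasoning
      by-parity : ∀ b → length (if b then I″ p j else I′ p j) + length (if b then I′ p j else I″ p j) ≡ 2 * p
      by-parity true  = trans (+-comm (length (I″ p j)) (length (I′ p j))) halves
      by-parity false = halves

  length-IT′ : length (IT′ p) ≡ p * p + p
  length-IT′ = begin
    length (IT′ p)                                                  ≡⟨ cong length IT′-blocks ⟩
    length ((rising (J p) H ++ falling (Ĵ p) H) ++ T′ p)             ≡⟨ length-++ (rising (J p) H ++ falling (Ĵ p) H) ⟩
    length (rising (J p) H ++ falling (Ĵ p) H) + length (T′ p)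
      ≡⟨ cong₂ _+_ (length-runs (J p) (Ĵ p) (2 * p) H (λ k 0<k k≤H → row-length 0<k (≤-<-trans k≤H H<p))) length-T′ ⟩
    H * (2 * p) + 2 * p                                             ≡⟨ count H p p-odd ⟩
    p * p + p                                                       ∎
    where
      open ≡-Reasoning
      count : ∀ H p → p ≡ 1 + 2 * H → H * (2 * p) + 2 * p ≡ p * p + p
      count H _ refl = arith H
        where
          arith : ∀ H → H * (2 * (1 + 2 * H)) + 2 * (1 + 2 * H) ≡ (1 + 2 * H) * (1 + 2 * H) + (1 + 2 * H)
          arith = solve-∀

theorem4 : (p : ℕ) .{{_ : NonZero p}} → Prime p → 2 < p →
    (length (IT′ p) ≡ p * p + p) × Is2Radius (IT′ p)
theorem4 p p-prime 2<p = length-IT′ , 2-radius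
  where open PrimeModulus p p-prime 2<p
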